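{- Let $X\subseteq\{0,1,2\}$ be arbitrary and let $p$ be any pattern in the symmetry class of $(12,X,\{0,1,2\})$ or of $(21,X,\{0,1,2\})$. Then for all $n\ge1$, $a_n(p)=n!-\mathbf{1}_{n=2}$, where $\mathbf{1}_{n=2}$ is $1$ if $n=2$ and $0$ otherwise.
   Context: A bi-vincular pattern of length $k$ is a triple $p=(\sigma,X,Y)$ with $\sigma$ a permutation of $[k]$ in one-line notation and $X,Y\subseteq\{0,1,\dots,k\}$. A permutation $\pi=\pi_1\cdots\pi_n$ of $[n]$ contains $p$ if there are indices $1\le i_1<\dots<i_k\le n$ such that $(\pi_{i_1},\dots,\pi_{i_k})$ is order-isomorphic to $\sigma$ and, writing $j_1<\dots<j_k$ for the set $\{\pi_{i_1},\dots,\pi_{i_k}\}$ in increasing order and setting $i_0=j_0=0$, $i_{k+1}=j_{k+1}=n+1$, we have $i_{x+1}=i_x+1$ for all $x\in X$ and $j_{y+1}=j_y+1$ for all $y\in Y$. Otherwise $\pi$ avoids $p$; $a_n(p)$ is the number of permutations of $[n]$ avoiding $p$. For $p=(\sigma,X,Y)$ of length $k$ define $p^{i}=(\sigma^{ -1},Y,X)$, $p^{r}=(\sigma^{r},\{k-x:x\in X\},Y)$, $p^{c}=(\sigma^{c},X,\{k-y:y\in Y\})$, with $\sigma^r_m=\sigma_{k+1-m}$ and $\sigma^c_m=k+1-\sigma_m$; the symmetry class of $p$ is the set of patterns obtained from $p$ by finite compositions of $i,r,c$. -}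

module Defs where

open import Data.Bool.Base using (Bool; true; false; not; _∧_; _∨_; if_then_else_)
open import Data.Nat.Base using (ℕ; zero; suc; _+_; _<ᵇ_; _≡ᵇ_)
open import Data.Nat.Base using (_≤ᵇ_)
open import Data.Fin.Base using (Fin; toℕ; opposite)
open import Data.Fin.Properties using (_≟_)
open import Data.Fin.Subset using (Subset; ⊤)
open import Data.List.Base as L using (List; []; _∷_; _++_; [_]; length; filterᵇ)
open import Data.Bool.ListAction using (all; any)
open import Data.Vec.Base as V using (Vec; []; _∷_; lookup; tabulate; reverse; toList)
open import Data.Vec.Functional using () renaming (toList to fToList)
open import Relation.Nullary.Decidable.Core using (⌊_⌋)

allFin : (k : ℕ) → List (Fin k)
allFin k = toList (tabulate (λ i → i))

allVecs : {A : Set} → List A → (n : ℕ) → List (Vec A n)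
allVecs xs zero    = [] ∷ []
allVecs xs (suc n) = L.concatMap (λ x → L.map (x ∷_) (allVecs xs n)) xs

-- all length-k subsequences (order preserved) of a list;
-- applied to allFin n this lists all index tuples i₁ < … < i_k
choose : {A : Set} → (k : ℕ) → List A → List (Vec A k)
choose zero    xs       = [] ∷ []
choose (suc k) []       = []
choose (suc k) (x ∷ xs) = L.map (x ∷_) (choose k xs) ++ choose (suc k) xs

-- Permutations of [n], in one-line notation, with entries in Fin n
-- (entry v : Fin n stands for the value toℕ v + 1 ∈ [n]).

injectiveᵇ : {n : ℕ} → Vec (Fin n) n → Bool
injectiveᵇ {n} π =
  all (λ a → all (λ b → ⌊ a ≟ b ⌋ ∨ not ⌊ lookup π a ≟ lookup π b ⌋) (allFin n)) (allFin n)

perms : (n : ℕ) → List (Vec (Fin n) n)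
perms n = filterᵇ injectiveᵇ (allVecs (allFin n) n)

-- Bi-vincular patterns (σ , X , Y) of length k.
-- σ is a permutation of [k] (entry m : Fin k stands for m+1);
-- X , Y ⊆ {0,…,k} are subsets of Fin (suc k).

record Pattern : Set where
  constructor pat
  field
    k : ℕ
    σ : Vec (Fin k) k
    X : Subset (suc k)
    Y : Subset (suc k)

open Pattern public

-- first position j with σ j = m (default m, never used for a permutation)
firstPos : {k : ℕ} → Vec (Fin k) k → Fin k → List (Fin k) → Fin k
firstPos σ m []       = m
firstPos σ m (j ∷ js) = if ⌊ lookup σ j ≟ m ⌋ then j else firstPos σ m js

inverse : {k : ℕ} → Vec (Fin k) k → Vec (Fin k) k
inverse {k} σ = tabulate (λ m → firstPos σ m (allFin k))

revPerm : {k : ℕ} → Vec (Fin k) k → Vec (Fin k) k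
revPerm = reverse

compPerm : {k : ℕ} → Vec (Fin k) k → Vec (Fin k) k
compPerm = V.map opposite

-- { k - x : x ∈ S } for S ⊆ {0,…,k}: reversing the characteristic vector
mirror : {k : ℕ} → Subset (suc k) → Subset (suc k)
mirror = reverse

_ⁱ : Pattern → Pattern
pat k σ X Y ⁱ = pat k (inverse σ) Y X

_ʳ : Pattern → Pattern
pat k σ X Y ʳ = pat k (revPerm σ) (mirror X) Y

_ᶜ : Pattern → Pattern
pat k σ X Y ᶜ = pat k (compPerm σ) X (mirror Y)

data SymClass (p : Pattern) : Pattern → Set where
  base : SymClass p p
  stepⁱ : ∀ {q} → SymClass p q → SymClass p (q ⁱ)
  stepʳ : ∀ {q} → SymClass p q → SymClass p (q ʳ)
  stepᶜ : ∀ {q} → SymClass p q → SymClass p (q ᶜ)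

-- total list indexing (default 0; only used within bounds)
at : List ℕ → ℕ → ℕ
at []       _       = 0
at (x ∷ xs) zero    = x
at (x ∷ xs) (suc m) = at xs m

insert : ℕ → List ℕ → List ℕ
insert x []       = x ∷ []
insert x (y ∷ ys) = if x ≤ᵇ y then x ∷ y ∷ ys else y ∷ insert x ys

sort : List ℕ → List ℕ
sort []       = []
sort (x ∷ xs) = insert x (sort xs)

extend : ℕ → List ℕ → List ℕ
extend n l = 0 ∷ (l ++ [ suc n ])

adjacentᵇ : {k : ℕ} → Subset (suc k) → List ℕ → Bool
adjacentᵇ {k} S e =
  all (λ x → not (lookup S x) ∨ (at e (suc (toℕ x)) ≡ᵇ suc (at e (toℕ x)))) (allFin (suc k))

occurrenceᵇ : {n : ℕ} → (p : Pattern) → Vec (Fin n) n → Vec (Fin n) (k p) → Bool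
occurrenceᵇ {n} (pat k σ X Y) π is =
  orderIso ∧ adjacentᵇ X iext ∧ adjacentᵇ Y jext
  where
  vals : Vec ℕ k
  vals = V.map (λ i → suc (toℕ (lookup π i))) is
  orderIso : Bool
  orderIso = all (λ a → all (λ b →
      (lookup vals a <ᵇ lookup vals b) ≡ᵇ' (toℕ (lookup σ a) <ᵇ toℕ (lookup σ b)))
      (allFin k)) (allFin k)
    where
    _≡ᵇ'_ : Bool → Bool → Bool
    true  ≡ᵇ' b = b
    false ≡ᵇ' b = not b
  iext : List ℕ              -- i_0 = 0, i_1, …, i_k, i_{k+1} = n+1 (1-based)
  iext = extend n (toList (V.map (λ i → suc (toℕ i)) is))
  jext : List ℕ
  jext = extend n (sort (toList vals))

containsᵇ : {n : ℕ} → Pattern → Vec (Fin n) n → Bool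
containsᵇ {n} p π = any (occurrenceᵇ p π) (choose (k p) (allFin n))

avoiders : ℕ → Pattern → ℕ
avoiders n p = length (filterᵇ (λ π → not (containsᵇ p π)) (perms n))

open import Data.Fin.Base using (zero; suc)

pat12 : Subset 3 → Pattern
pat12 X = pat 2 (zero ∷ suc zero ∷ []) X ⊤

pat21 : Subset 3 → Pattern
pat21 X = pat 2 (suc zero ∷ zero ∷ []) X ⊤

module Submission where

open import Defs
open import Data.Nat.Base using (ℕ; zero; suc; pred; _+_; _*_; _≤_; _∸_; _!; _≡ᵇ_; _≤ᵇ_)
open import Data.Bool.Base using (Bool; true; false; T; not; _∧_; _∨_; if_then_else_)
open import Data.Bool.Properties using (∧-zeroʳ; ∨-zeroʳ; T-∧; T-not-≡)
open import Data.Fin.Base using (Fin; zero; suc; toℕ)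
import Data.Fin.Properties as Fin
open import Data.Fin.Subset using (Subset; ⊤)
open import Data.Vec.Base as Vec using (Vec; []; _∷_; lookup)
open import Data.Vec.Properties using (tabulate∘lookup)
import Data.Vec.Relation.Unary.All as VecAll
open import Data.Vec.Relation.Unary.AllPairs using ([]; _∷_)
open import Data.Vec.Relation.Unary.Unique.Propositional as VecUnique using ()
open import Data.Vec.Relation.Unary.Unique.Propositional.Properties
  using (lookup-injective; tabulate⁺)
open import Data.List.Base as List
  using (List; []; _∷_; _++_; length; filter; filterᵇ; concatMap)
open import Data.List.Properties using (filter-++; filter-≐; filter-all; filter-none;
  filter-accept; filter-reject; length-++; length-map; length-tabulate)
open import Data.List.Relation.Unary.All as All using (All; []; _∷_)
open import Data.List.Relation.Unary.Any using (here; there)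
open import Data.List.Relation.Unary.AllPairs using (_∷_)
open import Data.List.Relation.Unary.Unique.Propositional using (Unique)
open import Data.List.Relation.Unary.Unique.Propositional.Properties
  using (allFin⁺; filter⁺)
open import Data.List.Membership.Propositional using (_∈_)
open import Data.List.Membership.Propositional.Properties using (∈-allFin)
open import Data.Bool.ListAction using (all; any)
open import Data.List.Relation.Unary.All.Properties using (all⁺; all⁻)
open import Data.Sum.Base using (_⊎_; inj₁; inj₂)
open import Data.Product.Base using (_,_)
open import Data.Empty using (⊥-elim)
open import Function.Base using (id)
open import Function.Bundles using (Equivalence; _⇔_; mk⇔)
import Function.Properties.Equivalence as ⇔
open import Relation.Binary.Definitions using (DecidableEquality)
open import Relation.Binary.PropositionalEquality
open import Relation.Nullary using (¬_; Dec; yes; no; ¬?; T?)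
open import Relation.Nullary.Decidable.Core using (⌊_⌋)

data IsPerm₂ : Vec (Fin 2) 2 → Set where
  ascending  : IsPerm₂ (zero ∷ suc zero ∷ [])
  descending : IsPerm₂ (suc zero ∷ zero ∷ [])

perm₂-inverse : ∀ {σ} → IsPerm₂ σ → IsPerm₂ (inverse σ)
perm₂-inverse ascending  = ascending
perm₂-inverse descending = descending

perm₂-reverse : ∀ {σ} → IsPerm₂ σ → IsPerm₂ (revPerm σ)
perm₂-reverse ascending  = descending
perm₂-reverse descending = ascending

perm₂-complement : ∀ {σ} → IsPerm₂ σ → IsPerm₂ (compPerm σ)
perm₂-complement ascending  = descending
perm₂-complement descending = ascending

-- a length-2 pattern whose positions or whose values must all be adjacent
data Rigid : Pattern → Set where
  rigidPositions : ∀ {σ} → IsPerm₂ σ → (Y : Subset 3) → Rigid (pat 2 σ ⊤ Y)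
  rigidValues    : ∀ {σ} → IsPerm₂ σ → (X : Subset 3) → Rigid (pat 2 σ X ⊤)

-- inverse exchanges the two kinds of rigidity; reverse and complement keep
-- the full set {0,1,2} full, as it is its own mirror image
rigidⁱ : ∀ {p} → Rigid p → Rigid (p ⁱ)
rigidⁱ (rigidPositions perm Y) = rigidValues (perm₂-inverse perm) Y
rigidⁱ (rigidValues perm X)    = rigidPositions (perm₂-inverse perm) X

rigidʳ : ∀ {p} → Rigid p → Rigid (p ʳ)
rigidʳ (rigidPositions perm Y) = rigidPositions (perm₂-reverse perm) Y
rigidʳ (rigidValues perm X)    = rigidValues (perm₂-reverse perm) (mirror X)

rigidᶜ : ∀ {p} → Rigid p → Rigid (p ᶜ)
rigidᶜ (rigidPositions perm Y) = rigidPositions (perm₂-complement perm) (mirror Y)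
rigidᶜ (rigidValues perm X)    = rigidValues (perm₂-complement perm) X

symClass-rigid : ∀ {p q} → Rigid p → SymClass p q → Rigid q
symClass-rigid r base      = r
symClass-rigid r (stepⁱ s) = rigidⁱ (symClass-rigid r s)
symClass-rigid r (stepʳ s) = rigidʳ (symClass-rigid r s)
symClass-rigid r (stepᶜ s) = rigidᶜ (symClass-rigid r s)

-- the sentinel-extended sequence 0, a, b, n+1 has all three gaps equal
-- to 1 only when n = 2
full-adjacency-fails : ∀ {n} a b → n ≢ 2 →
  adjacentᵇ {2} ⊤ (extend n (a ∷ b ∷ [])) ≡ false
full-adjacency-fails zero b _ = refl
full-adjacency-fails (suc (suc a)) b _ = refl
full-adjacency-fails (suc zero) zero _ = refl
full-adjacency-fails (suc zero) (suc zero) _ = refl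
full-adjacency-fails (suc zero) (suc (suc (suc b))) _ = refl
full-adjacency-fails {zero} (suc zero) (suc (suc zero)) _ = refl
full-adjacency-fails {suc zero} (suc zero) (suc (suc zero)) _ = refl
full-adjacency-fails {suc (suc zero)} (suc zero) (suc (suc zero)) n≢2 = ⊥-elim (n≢2 refl)
full-adjacency-fails {suc (suc (suc n))} (suc zero) (suc (suc zero)) _ = refl

sorted-full-adjacency-fails : ∀ {n} a b → n ≢ 2 →
  adjacentᵇ {2} ⊤ (extend n (sort (a ∷ b ∷ []))) ≡ false
sorted-full-adjacency-fails a b n≢2 with a ≤ᵇ b
... | true  = full-adjacency-fails a b n≢2
... | false = full-adjacency-fails b a n≢2

-- hence no pair of indices is an occurrence of a rigid pattern: the
-- adjacency conjunct for the full set evaluates to false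
rigid-no-occurrence : ∀ {n p} → Rigid p → n ≢ 2 →
  (π : Vec (Fin n) n) (is : Vec (Fin n) (k p)) → occurrenceᵇ p π is ≡ false
rigid-no-occurrence (rigidPositions _ Y) n≢2 π (i ∷ j ∷ [])
  rewrite full-adjacency-fails (suc (toℕ i)) (suc (toℕ j)) n≢2 = ∧-zeroʳ _
rigid-no-occurrence {n} (rigidValues _ X) n≢2 π (i ∷ j ∷ [])
  rewrite sorted-full-adjacency-fails (suc (toℕ (lookup π i))) (suc (toℕ (lookup π j))) n≢2
        | ∧-zeroʳ (adjacentᵇ X (extend n (suc (toℕ i) ∷ suc (toℕ j) ∷ []))) = ∧-zeroʳ _

-- positions and values 0, 1, 2, 3 are consecutive, so every adjacency
-- requirement is met
consecutive-adjacent : (S : Subset 3) → adjacentᵇ S (extend 2 (1 ∷ 2 ∷ [])) ≡ true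
consecutive-adjacent (a ∷ b ∷ c ∷ [])
  rewrite ∨-zeroʳ (not a) | ∨-zeroʳ (not b) | ∨-zeroʳ (not c) = refl

-- for n = 2 only the occurrence (1,2) exists; it matches σ precisely in the
-- permutation σ itself, whatever X and Y are
length-two-avoiders : ∀ {σ} → IsPerm₂ σ → (X Y : Subset 3) → avoiders 2 (pat 2 σ X Y) ≡ 1
length-two-avoiders ascending X Y
  rewrite consecutive-adjacent X | consecutive-adjacent Y = refl
length-two-avoiders descending X Y
  rewrite consecutive-adjacent X | consecutive-adjacent Y = refl

module _ {A : Set} where

  filterᵇ-⇔ : (f g : A → Bool) → (∀ x → T (f x) ⇔ T (g x)) → ∀ xs → filterᵇ f xs ≡ filterᵇ g xs
  filterᵇ-⇔ f g f⇔g = filter-≐ (λ x → T? (f x)) (λ x → T? (g x))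
    ((λ {x} → Equivalence.to (f⇔g x)) , (λ {x} → Equivalence.from (f⇔g x)))

  filterᵇ-cong : {f g : A → Bool} → (∀ x → f x ≡ g x) → ∀ xs → filterᵇ f xs ≡ filterᵇ g xs
  filterᵇ-cong {f} {g} f≗g = filterᵇ-⇔ f g (λ x → mk⇔ (subst T (f≗g x)) (subst T (sym (f≗g x))))

  filterᵇ-∧ : (f g : A → Bool) → ∀ xs → filterᵇ (λ x → g x ∧ f x) xs ≡ filterᵇ f (filterᵇ g xs)
  filterᵇ-∧ f g [] = refl
  filterᵇ-∧ f g (x ∷ xs) with g x
  ... | false = filterᵇ-∧ f g xs
  ... | true with f x
  ...   | true  = cong (x ∷_) (filterᵇ-∧ f g xs)
  ...   | false = filterᵇ-∧ f g xs

  length-concatMap-const : ∀ {B : Set} {f : A → List B} {c} xs →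
    All (λ x → length (f x) ≡ c) xs → length (concatMap f xs) ≡ length xs * c
  length-concatMap-const [] [] = refl
  length-concatMap-const {f = f} (x ∷ xs) (eq ∷ eqs) =
    trans (length-++ (f x)) (cong₂ _+_ eq (length-concatMap-const xs eqs))

  any-false : (f : A → Bool) → (∀ x → f x ≡ false) → ∀ xs → any f xs ≡ false
  any-false f f≡false []       = refl
  any-false f f≡false (x ∷ xs) rewrite f≡false x = any-false f f≡false xs

module _ {A B : Set} where

  filterᵇ-map : (f : B → Bool) (g : A → B) → ∀ xs →
    filterᵇ f (List.map g xs) ≡ List.map g (filterᵇ (λ x → f (g x)) xs)
  filterᵇ-map f g [] = refl
  filterᵇ-map f g (x ∷ xs) with f (g x)
  ... | true  = cong (g x ∷_) (filterᵇ-map f g xs)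
  ... | false = filterᵇ-map f g xs

  filterᵇ-concatMap : (f : B → Bool) (g : A → List B) → ∀ xs →
    filterᵇ f (concatMap g xs) ≡ concatMap (λ x → filterᵇ f (g x)) xs
  filterᵇ-concatMap f g [] = refl
  filterᵇ-concatMap f g (x ∷ xs) =
    trans (filter-++ _ (g x) (concatMap g xs)) (cong (filterᵇ f (g x) ++_) (filterᵇ-concatMap f g xs))

falling : ℕ → ℕ → ℕ
falling L zero    = 1
falling L (suc m) = L * falling (pred L) m

falling-diagonal : ∀ n → falling n n ≡ n !
falling-diagonal zero    = refl
falling-diagonal (suc n) = cong (suc n *_) (falling-diagonal n)

module InjectiveWords {A : Set} (_≟_ : DecidableEquality A) where

  fresh : ∀ {m} → A → Vec A m → Bool
  fresh x []      = true
  fresh x (y ∷ v) = not ⌊ x ≟ y ⌋ ∧ fresh x v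

  distinct : ∀ {m} → Vec A m → Bool
  distinct []      = true
  distinct (x ∷ v) = fresh x v ∧ distinct v

  remove : A → List A → List A
  remove x = filter (λ y → ¬? (x ≟ y))

  not-fresh-self : ∀ {m} x (v : Vec A m) → ¬ T (fresh x (x ∷ v))
  not-fresh-self x v with x ≟ x
  ... | yes _   = λ ()
  ... | no x≢x = ⊥-elim (x≢x refl)

  fresh-other : ∀ {m x y} → x ≢ y → (v : Vec A m) → fresh x (y ∷ v) ≡ fresh x v
  fresh-other {x = x} {y} x≢y v with x ≟ y
  ... | yes x≡y = ⊥-elim (x≢y x≡y)
  ... | no _    = refl

  words-without : ∀ x xs m → filterᵇ (fresh x) (allVecs xs m) ≡ allVecs (remove x xs) m
  words-without x xs zero    = refl
  words-without x xs (suc m) =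
    trans (filterᵇ-concatMap (fresh x) (λ y → List.map (y ∷_) (allVecs xs m)) xs)
          (by-first-letter xs)
    where
    starting : A → List (Vec A (suc m))
    starting y = filterᵇ (fresh x) (List.map (y ∷_) (allVecs xs m))

    starting-self : starting x ≡ []
    starting-self = trans (filterᵇ-map (fresh x) (x ∷_) (allVecs xs m))
      (cong (List.map (x ∷_)) (filter-none _ (All.universal (not-fresh-self x) (allVecs xs m))))

    starting-other : ∀ {y} → x ≢ y → starting y ≡ List.map (y ∷_) (allVecs (remove x xs) m)
    starting-other {y} x≢y = trans (filterᵇ-map (fresh x) (y ∷_) (allVecs xs m))
      (cong (List.map (y ∷_)) (trans (filterᵇ-cong (fresh-other x≢y) (allVecs xs m))
                                     (words-without x xs m)))

    by-first-letter : ∀ ys → concatMap starting ys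
      ≡ concatMap (λ y → List.map (y ∷_) (allVecs (remove x xs) m)) (remove x ys)
    by-first-letter [] = refl
    by-first-letter (y ∷ ys) with x ≟ y
    ... | yes refl = trans (cong (_++ concatMap starting ys) starting-self) (by-first-letter ys)
    ... | no x≢y   = cong₂ _++_ (starting-other x≢y) (by-first-letter ys)

  length-remove : ∀ {x xs} → x ∈ xs → Unique xs → length (remove x xs) ≡ pred (length xs)
  length-remove {x} {x ∷ zs} (here refl) (x∉zs ∷ _) =
    trans (cong length (filter-reject (λ y → ¬? (x ≟ y)) (λ x≢x → x≢x refl)))
          (cong length (filter-all (λ y → ¬? (x ≟ y)) x∉zs))
  length-remove {x} {z ∷ w ∷ ws} (there x∈zs) (z∉zs ∷ zs-unique) =
    trans (cong length (filter-accept (λ y → ¬? (x ≟ y)) λ x≡z → All.lookup z∉zs x∈zs (sym x≡z)))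
          (cong suc (length-remove x∈zs zs-unique))

  count-distinct : ∀ m {xs} → Unique xs →
    length (filterᵇ distinct (allVecs xs m)) ≡ falling (length xs) m
  count-distinct zero    _ = refl
  count-distinct (suc m) {xs} xs-unique = begin
    length (filterᵇ distinct (concatMap (λ y → List.map (y ∷_) (allVecs xs m)) xs))
      ≡⟨ cong length (filterᵇ-concatMap distinct _ xs) ⟩
    length (concatMap (λ y → filterᵇ distinct (List.map (y ∷_) (allVecs xs m))) xs)
      ≡⟨ length-concatMap-const xs (All.tabulate starting-with) ⟩
    length xs * falling (pred (length xs)) m ∎
    where
    open ≡-Reasoning
    starting-with : ∀ {y} → y ∈ xs →
      length (filterᵇ distinct (List.map (y ∷_) (allVecs xs m))) ≡ falling (pred (length xs)) m
    starting-with {y} y∈xs = begin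
      length (filterᵇ distinct (List.map (y ∷_) (allVecs xs m)))
        ≡⟨ cong length (filterᵇ-map distinct (y ∷_) (allVecs xs m)) ⟩
      length (List.map (y ∷_) (filterᵇ (λ v → fresh y v ∧ distinct v) (allVecs xs m)))
        ≡⟨ length-map (Vec._∷_ y) (filterᵇ (λ v → fresh y v ∧ distinct v) (allVecs xs m)) ⟩
      length (filterᵇ (λ v → fresh y v ∧ distinct v) (allVecs xs m))
        ≡⟨ cong length (filterᵇ-∧ distinct (fresh y) (allVecs xs m)) ⟩
      length (filterᵇ distinct (filterᵇ (fresh y) (allVecs xs m)))
        ≡⟨ cong (λ ws → length (filterᵇ distinct ws)) (words-without y xs m) ⟩
      length (filterᵇ distinct (allVecs (remove y xs) m))
        ≡⟨ count-distinct m (filter⁺ _ xs-unique) ⟩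
      falling (length (remove y xs)) m
        ≡⟨ cong (λ L → falling L m) (length-remove y∈xs xs-unique) ⟩
      falling (pred (length xs)) m ∎

  fresh⇔all : ∀ {m} x (v : Vec A m) → T (fresh x v) ⇔ VecAll.All (x ≢_) v
  fresh⇔all x []      = mk⇔ (λ _ → VecAll.[]) (λ _ → _)
  fresh⇔all x (y ∷ v) with x ≟ y
  ... | yes x≡y = mk⇔ (λ ()) (λ { (x≢y VecAll.∷ _) → x≢y x≡y })
  ... | no x≢y  = mk⇔ (λ h → x≢y VecAll.∷ Equivalence.to (fresh⇔all x v) h)
                      (λ { (_ VecAll.∷ h) → Equivalence.from (fresh⇔all x v) h })

  distinct⇔unique : ∀ {m} (v : Vec A m) → T (distinct v) ⇔ VecUnique.Unique v
  distinct⇔unique []      = mk⇔ (λ _ → []) (λ _ → _)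
  distinct⇔unique (x ∷ v) = mk⇔
    (λ h → let fresh-x , distinct-v = Equivalence.to (T-∧ {fresh x v}) h
           in Equivalence.to (fresh⇔all x v) fresh-x ∷ Equivalence.to (distinct⇔unique v) distinct-v)
    (λ { (x∉v ∷ unique-v) → Equivalence.from T-∧
           (Equivalence.from (fresh⇔all x v) x∉v , Equivalence.from (distinct⇔unique v) unique-v) })

toList-tabulate : ∀ {A : Set} {k} (f : Fin k → A) → Vec.toList (Vec.tabulate f) ≡ List.tabulate f
toList-tabulate {k = zero}  f = refl
toList-tabulate {k = suc k} f = cong (f zero ∷_) (toList-tabulate (λ i → f (suc i)))

allFin-list : ∀ k → allFin k ≡ List.allFin k
allFin-list k = toList-tabulate id

all-allFin : ∀ {k} (f : Fin k → Bool) → T (all f (allFin k)) ⇔ (∀ i → T (f i))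
all-allFin {k} f rewrite allFin-list k = mk⇔
  (λ h i → All.lookup (all⁺ f (List.allFin k) h) (∈-allFin i))
  (λ h → all⁻ f {List.allFin k} (All.tabulate (λ {i} _ → h i)))

implication-test : ∀ {A B : Set} {a a' : A} {b b' : B} (a? : Dec (a ≡ a')) (b? : Dec (b ≡ b')) →
  T (⌊ a? ⌋ ∨ not ⌊ b? ⌋) ⇔ (b ≡ b' → a ≡ a')
implication-test (yes a≡a') _          = mk⇔ (λ _ _ → a≡a') (λ _ → _)
implication-test (no _)     (no b≢b')  = mk⇔ (λ _ b≡b' → ⊥-elim (b≢b' b≡b')) (λ _ → _)
implication-test (no a≢a')  (yes b≡b') = mk⇔ (λ ()) (λ h → a≢a' (h b≡b'))

injectiveᵇ⇔injective : ∀ {n} (π : Vec (Fin n) n) →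
  T (injectiveᵇ π) ⇔ (∀ a b → lookup π a ≡ lookup π b → a ≡ b)
injectiveᵇ⇔injective π = mk⇔
  (λ h a b → Equivalence.to (test a b) (Equivalence.to (all-allFin _) (Equivalence.to (all-allFin _) h a) b))
  (λ inj → Equivalence.from (all-allFin _) λ a →
             Equivalence.from (all-allFin _) λ b → Equivalence.from (test a b) (inj a b))
  where
  test : ∀ a b → T (⌊ a Fin.≟ b ⌋ ∨ not ⌊ lookup π a Fin.≟ lookup π b ⌋) ⇔ (lookup π a ≡ lookup π b → a ≡ b)
  test a b = implication-test (a Fin.≟ b) (lookup π a Fin.≟ lookup π b)

unique⇔injective : ∀ {A : Set} {n} (v : Vec A n) →
  VecUnique.Unique v ⇔ (∀ a b → lookup v a ≡ lookup v b → a ≡ b)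
unique⇔injective v = mk⇔ lookup-injective
  (λ inj → subst VecUnique.Unique (tabulate∘lookup v) (tabulate⁺ (λ {a} {b} → inj a b)))

-- the permutations of [n] are the injective words of length n over [n]
length-perms : ∀ n → length (perms n) ≡ n !
length-perms n = begin
  length (filterᵇ injectiveᵇ (allVecs (allFin n) n))
    ≡⟨ cong length (filterᵇ-⇔ injectiveᵇ distinct same-test (allVecs (allFin n) n)) ⟩
  length (filterᵇ distinct (allVecs (allFin n) n))
    ≡⟨ count-distinct n (subst Unique (sym (allFin-list n)) (allFin⁺ n)) ⟩
  falling (length (allFin n)) n
    ≡⟨ cong (λ L → falling L n) (trans (cong length (allFin-list n)) (length-tabulate id)) ⟩
  falling n n
    ≡⟨ falling-diagonal n ⟩
  n ! ∎
  where
  open ≡-Reasoning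
  open InjectiveWords (Fin._≟_ {n}) using (distinct; distinct⇔unique; count-distinct)
  same-test : ∀ (π : Vec (Fin n) n) → T (injectiveᵇ π) ⇔ T (distinct π)
  same-test π = ⇔.trans (injectiveᵇ⇔injective π)
                          (⇔.sym (⇔.trans (distinct⇔unique π) (unique⇔injective π)))

rigid-avoiders-away-from-two : ∀ {n p} → Rigid p → n ≢ 2 → avoiders n p ≡ n !
rigid-avoiders-away-from-two {n} {p} r n≢2 =
  trans (cong length (filter-all _ (All.universal avoids (perms n)))) (length-perms n)
  where
  avoids : ∀ π → T (not (containsᵇ p π))
  avoids π = Equivalence.from T-not-≡
    (any-false (occurrenceᵇ p π) (rigid-no-occurrence r n≢2 π) (choose (k p) (allFin n)))

rigid-length-two : ∀ {p} → Rigid p → avoiders 2 p ≡ 1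
rigid-length-two (rigidPositions perm Y) = length-two-avoiders perm ⊤ Y
rigid-length-two (rigidValues perm X)    = length-two-avoiders perm X ⊤

rigid-avoiders : ∀ {p} → Rigid p → ∀ n → avoiders n p ≡ n ! ∸ (if n ≡ᵇ 2 then 1 else 0)
rigid-avoiders r zero                = rigid-avoiders-away-from-two {0} r (λ ())
rigid-avoiders r (suc zero)          = rigid-avoiders-away-from-two {1} r (λ ())
rigid-avoiders r (suc (suc zero))    = rigid-length-two r
rigid-avoiders r (suc (suc (suc n))) = rigid-avoiders-away-from-two {3 + n} r (λ ())

-- (12, X, {0,1,2}) and (21, X, {0,1,2}) are rigid, hence so is their whole
-- symmetry class
mainTheorem6 : (X : Subset 3) (p : Pattern) →
    SymClass (pat12 X) p ⊎ SymClass (pat21 X) p →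
    (n : ℕ) → 1 ≤ n →
    avoiders n p ≡ n ! ∸ (if n ≡ᵇ 2 then 1 else 0)
mainTheorem6 X p (inj₁ s) n _ = rigid-avoiders (symClass-rigid (rigidValues ascending X) s) n
mainTheorem6 X p (inj₂ s) n _ = rigid-avoiders (symClass-rigid (rigidValues descending X) s) n
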